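{- Let $N$ be a homogeneous network with asymmetric inputs. Then $N$ is a fundamental network (i.e., $N$ is isomorphic to the fundamental network of some homogeneous network with asymmetric inputs) if and only if there is a cell $c$ of $N$ such that $N$ is backward connected for $c$ and transitive for $c$.
   Context: A homogeneous network with asymmetric inputs has a finite cell set $C$, one cell type, $k$ edge types, each cell receiving exactly one edge of each type; it is represented by $\sigma_1,\dots,\sigma_k:C\to C$ (type-$i$ edge into $c$ comes from $\sigma_i(c)$). A network fibration between such networks is (determined by) a cell map $\varphi$ with $\varphi\circ\sigma_i=\sigma'_i\circ\varphi$ for all $i$; an isomorphism is a bijective network fibration. $N$ is backward connected for $c$ if every cell $c'\neq c$ has a directed path to $c$ (i.e. $c'=\sigma_{j_m}\circ\dots\circ\sigma_{j_1}(c)$ for some indices). $N$ is transitive for $c$ if for every cell $d$ there is a network fibration $\phi_d:N\to N$ with $\phi_d(c)=d$. The fundamental network $\tilde{M}$ of a homogeneous network with asymmetric inputs $M$ (cells $C_M$, representing maps $\mu_i$) has as cells the semigroup of maps $C_M\to C_M$ generated under composition by $Id$ and the $\mu_i$, represented by $\tilde{\mu}_i(\gamma)=\mu_i\circ\gamma$. -}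

module Defs where

open import Data.Nat using (ℕ)
open import Data.Fin using (Fin)
open import Data.List using (List; []; _∷_)
open import Data.Product using (Σ; ∃; _×_; _,_)
open import Relation.Binary.PropositionalEquality using (_≡_; _≢_)

-- A homogeneous network with asymmetric inputs with n cells (Fin n) and
-- k edge types is given by its representing maps σ i : Fin n → Fin n
-- (the type-i edge into c comes from σ i c).
Net : ℕ → ℕ → Set
Net n k = Fin k → Fin n → Fin n

Word : ℕ → Set
Word k = List (Fin k)

run : ∀ {n k} → Net n k → Word k → Fin n → Fin n
run σ []      c = c
run σ (j ∷ w) c = σ j (run σ w c)

-- Network fibration N → N' (determined by its cell map).
IsFibration : ∀ {n n' k} → Net n k → Net n' k → (Fin n → Fin n') → Set
IsFibration σ σ' φ = ∀ i c → φ (σ i c) ≡ σ' i (φ c)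

BackwardConnected : ∀ {n k} → Net n k → Fin n → Set
BackwardConnected σ c = ∀ c' → c' ≢ c → ∃ λ (w : Word _) → c' ≡ run σ w c

Transitive : ∀ {n k} → Net n k → Fin n → Set
Transitive {n} σ c = ∀ (d : Fin n) → Σ (Fin n → Fin n) λ φ → IsFibration σ σ φ × φ c ≡ d

-- Fundamental network of M = (m cells, maps μ).  Its cells are the elements
-- of the semigroup of maps Fin m → Fin m generated by Id and the μ i, i.e.
-- the maps  run μ w  for words w, where two words denote the same cell iff
-- they denote the same map.  μ̃ i (run μ w) = μ i ∘ run μ w = run μ (i ∷ w).
SameCell : ∀ {m k} → Net m k → Word k → Word k → Set
SameCell μ w w' = ∀ x → run μ w x ≡ run μ w' x

-- N is isomorphic to the fundamental network of M: a bijective network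
-- fibration φ from N to M̃ (cells of M̃ represented by words up to SameCell).
IsoToFundamental : ∀ {n m k} → Net n k → Net m k → Set
IsoToFundamental {n} {m} {k} σ μ =
  Σ (Fin n → Word k) λ φ →
      (∀ i c → SameCell μ (φ (σ i c)) (i ∷ φ c))
    × (∀ c d → SameCell μ (φ c) (φ d) → c ≡ d)
    × (∀ (w : Word k) → ∃ λ c → SameCell μ (φ c) w)

IsFundamental : ∀ {n k} → Net n k → Set
IsFundamental {n} {k} σ = ∃ λ (m : ℕ) → Σ (Net m k) λ μ → IsoToFundamental σ μ

-- The fundamental network of M has the identity map as a distinguished cell:
-- every cell γ is reached from Id along the word that denotes γ, and right
-- composition γ ↦ γ ∘ δ is a self-fibration sending Id to δ.  Conversely,
-- if N is backward connected and transitive for c, the self-fibration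
-- sending c to x carries run w c to run w x, so the cell run w c determines
-- the whole map run w; sending each cell to a word that reaches it from c is
-- then an isomorphism from N onto the fundamental network of N itself.
module Submission where

open import Defs
open import Data.Nat using (ℕ)
open import Data.Fin using (Fin; _≟_)
open import Data.List using ([]; _∷_; _++_)
open import Data.Product using (∃; _×_; _,_; proj₁; proj₂)
open import Function.Bundles using (_⇔_; mk⇔)
open import Relation.Binary.PropositionalEquality
open import Relation.Nullary using (yes; no)

run-++ : ∀ {n k} (σ : Net n k) u v x → run σ (u ++ v) x ≡ run σ u (run σ v x)
run-++ σ []      v x = refl
run-++ σ (j ∷ u) v x = cong (σ j) (run-++ σ u v x)

fibration-run : ∀ {n n' k} {σ : Net n k} {σ' : Net n' k} {φ : Fin n → Fin n'} →
  IsFibration σ σ' φ → ∀ w x → φ (run σ w x) ≡ run σ' w (φ x)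
fibration-run             isφ []      x = refl
fibration-run {σ' = σ'} isφ (j ∷ w) x =
  trans (isφ j _) (cong (σ' j) (fibration-run isφ w x))

module FromIsoToFundamental {n m k} (σ : Net n k) (μ : Net m k)
                            (iso : IsoToFundamental σ μ) where

  φ : Fin n → Word k
  φ = proj₁ iso

  φ-fibration : ∀ i c → SameCell μ (φ (σ i c)) (i ∷ φ c)
  φ-fibration = proj₁ (proj₂ iso)

  φ-injective : ∀ c d → SameCell μ (φ c) (φ d) → c ≡ d
  φ-injective = proj₁ (proj₂ (proj₂ iso))

  φ-surjective : ∀ w → ∃ λ c → SameCell μ (φ c) w
  φ-surjective = proj₂ (proj₂ (proj₂ iso))

  φ-run : ∀ w c x → run μ (φ (run σ w c)) x ≡ run μ w (run μ (φ c) x)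
  φ-run []      c x = refl
  φ-run (j ∷ w) c x = trans (φ-fibration j (run σ w c) x) (cong (μ j) (φ-run w c x))

  identityCell : Fin n
  identityCell = proj₁ (φ-surjective [])

  φ-identityCell : ∀ x → run μ (φ identityCell) x ≡ x
  φ-identityCell = proj₂ (φ-surjective [])

  φ-run-identityCell : ∀ w x → run μ (φ (run σ w identityCell)) x ≡ run μ w x
  φ-run-identityCell w x = trans (φ-run w identityCell x) (cong (run μ w) (φ-identityCell x))

  backwardConnected : BackwardConnected σ identityCell
  backwardConnected c _ =
    φ c , φ-injective c _ λ x → sym (φ-run-identityCell (φ c) x)

  composeRight : Fin n → Fin n → Fin n
  composeRight d c = proj₁ (φ-surjective (φ c ++ φ d))

  φ-composeRight : ∀ d c x → run μ (φ (composeRight d c)) x ≡ run μ (φ c) (run μ (φ d) x)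
  φ-composeRight d c x =
    trans (proj₂ (φ-surjective (φ c ++ φ d)) x) (run-++ μ (φ c) (φ d) x)

  composeRight-fibration : ∀ d → IsFibration σ σ (composeRight d)
  composeRight-fibration d i c = φ-injective _ _ λ x → begin
    run μ (φ (composeRight d (σ i c))) x  ≡⟨ φ-composeRight d (σ i c) x ⟩
    run μ (φ (σ i c)) (run μ (φ d) x)     ≡⟨ φ-fibration i c _ ⟩
    μ i (run μ (φ c) (run μ (φ d) x))     ≡⟨ cong (μ i) (φ-composeRight d c x) ⟨
    μ i (run μ (φ (composeRight d c)) x)  ≡⟨ φ-fibration i (composeRight d c) x ⟨
    run μ (φ (σ i (composeRight d c))) x  ∎
    where open ≡-Reasoning

  transitive : Transitive σ identityCell
  transitive d = composeRight d , composeRight-fibration d ,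
    φ-injective _ d λ x → trans (φ-composeRight d identityCell x) (φ-identityCell _)

module FromBackwardConnectedTransitive {n k} (σ : Net n k) (c : Fin n)
         (connected : BackwardConnected σ c) (transitive : Transitive σ c) where

  run-determined : ∀ w x → run σ w x ≡ proj₁ (transitive x) (run σ w c)
  run-determined w x = sym (begin
    ψ (run σ w c)  ≡⟨ fibration-run ψ-fibration w c ⟩
    run σ w (ψ c)  ≡⟨ cong (run σ w) ψc≡x ⟩
    run σ w x      ∎)
    where
    open ≡-Reasoning
    ψ = proj₁ (transitive x)
    ψ-fibration = proj₁ (proj₂ (transitive x))
    ψc≡x = proj₂ (proj₂ (transitive x))

  sameCell-fromBase : ∀ u v → run σ u c ≡ run σ v c → SameCell σ u v
  sameCell-fromBase u v eq x =
    trans (run-determined u x)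
      (trans (cong (proj₁ (transitive x)) eq) (sym (run-determined v x)))

  wordTo : Fin n → Word k
  wordTo d with d ≟ c
  ... | yes _  = []
  ... | no d≢c = proj₁ (connected d d≢c)

  run-wordTo : ∀ d → run σ (wordTo d) c ≡ d
  run-wordTo d with d ≟ c
  ... | yes d≡c = sym d≡c
  ... | no d≢c  = sym (proj₂ (connected d d≢c))

  isoToFundamental : IsoToFundamental σ σ
  isoToFundamental = wordTo , fibration , injective , surjective
    where
    fibration : ∀ i d → SameCell σ (wordTo (σ i d)) (i ∷ wordTo d)
    fibration i d = sameCell-fromBase (wordTo (σ i d)) (i ∷ wordTo d)
      (trans (run-wordTo (σ i d)) (cong (σ i) (sym (run-wordTo d))))

    injective : ∀ d e → SameCell σ (wordTo d) (wordTo e) → d ≡ e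
    injective d e same = trans (sym (run-wordTo d)) (trans (same c) (run-wordTo e))

    surjective : ∀ w → ∃ λ d → SameCell σ (wordTo d) w
    surjective w = run σ w c , sameCell-fromBase (wordTo (run σ w c)) w (run-wordTo (run σ w c))

mainTheorem13 : ∀ {n k : ℕ} (σ : Net n k) →
    IsFundamental σ ⇔ (∃ λ (c : Fin n) → BackwardConnected σ c × Transitive σ c)
mainTheorem13 σ = mk⇔
  (λ { (_ , μ , iso) → let open FromIsoToFundamental σ μ iso in
                       identityCell , backwardConnected , transitive })
  (λ { (c , connected , transitive) →
       _ , σ , FromBackwardConnectedTransitive.isoToFundamental σ c connected transitive })
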